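{- Let $\mathbb{T}$ be an algebraic theory and let $\mathcal{S}$ be a $\mathbb{T}$-comodel in $\mathbf{Set}$ with underlying set $S$. Equip $S$ with its operational topology. Then for every function symbol $\sigma$ of $\mathbb{T}$, the co-operation $[\![\sigma]\!]^{\mathcal{S}} \colon S \to |\sigma| \times S$ is continuous, where $|\sigma|\times S$ carries the product of the discrete topology on $|\sigma|$ and the operational topology on $S$; hence $\mathcal{S}$ becomes a topological $\mathbb{T}$-comodel. Moreover, if $\mathcal{F}$ is a final $\mathbb{T}$-comodel in $\mathbf{Set}$, then $\mathcal{F}$ equipped with its operational topology is a final object in the category of topological $\mathbb{T}$-comodels.
   Context: A signature is a set $\Sigma$ of function symbols, each $\sigma\in\Sigma$ having an arity set $|\sigma|$. The set $\Sigma(V)$ of terms in variables $V$ is defined inductively: each $v\in V$ is a term, and if $\sigma\in\Sigma$ and $t\in\Sigma(V)^{|\sigma|}$ then $\sigma(t)$ is a term. An algebraic theory $\mathbb{T}$ is a signature together with a set of equations $t=u$ between terms in the same variables; $T(V)$ denotes $\Sigma(V)$ modulo the least substitution-congruence containing the equations. A $\mathbb{T}$-comodel in a category $\mathcal{C}$ with copowers is a model of $\mathbb{T}$ in $\mathcal{C}^{\mathrm{op}}$: an object $S$ with co-operations $[\![\sigma]\!]\colon S\to |\sigma|\cdot S$ satisfying the equations of $\mathbb{T}$ (in $\mathcal{C}^{\mathrm{op}}$). In $\mathbf{Set}$, $|\sigma|\cdot S=|\sigma|\times S$; in $\mathbf{Top}$, $|\sigma|\cdot S$ is the coproduct of $|\sigma|$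 copies of $S$, i.e. $|\sigma|\times S$ with $|\sigma|$ discrete. A topological comodel is a comodel in $\mathbf{Top}$; morphisms of comodels are maps commuting with the co-operations (continuous ones in $\mathbf{Top}$). For a $\mathbf{Set}$-comodel $\mathcal{S}$ and $t\in T(V)$ the derived co-operation $[\![t]\!]^{\mathcal{S}}\colon S\to V\times S$ is given by $[\![v]\!](s)=(v,s)$ and $[\![\sigma(t)]\!](s)=[\![t_i]\!](s')$ where $[\![\sigma]\!](s)=(i,s')$. The operational topology on $S$ is the topology generated by the subbasic sets $[t\mapsto v]=\{s\in S: [\![t]\!]^{\mathcal{S}}(s)=(v,s')\text{ for some } s'\}$, for all sets $V$, $t\in T(V)$, $v\in V$. -}

module Defs where

open import Level using (Level)
open import Data.Unit using (⊤)
open import Data.Product using (Σ; _×_; _,_; proj₁; proj₂; map₂)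
open import Relation.Binary.PropositionalEquality using (_≡_)
open import Function.Bundles using (_⇔_)

Pred₀ : Set → Set₁
Pred₀ X = X → Set

-- A topology on X: a family of open subsets (predicates) closed under
-- pointwise equivalence (subsets are predicates, so extensional closure
-- is needed), containing the whole space, closed under binary
-- intersections and arbitrary (Set-indexed) unions.
record Topology (X : Set) : Set₂ where
  field
    Open   : Pred₀ X → Set₁
    ext    : ∀ {U W : Pred₀ X} → (∀ x → U x ⇔ W x) → Open U → Open W
    whole  : Open (λ _ → ⊤)
    inter  : ∀ {U W} → Open U → Open W → Open (λ x → U x × W x)
    union  : ∀ {I : Set} (U : I → Pred₀ X) → (∀ i → Open (U i))
             → Open (λ x → Σ I (λ i → U i x))
open Topology public

data GenOpen {X : Set} (Basic : Pred₀ X → Set₁) : Pred₀ X → Set₁ where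
  gbasic : ∀ {U} → Basic U → GenOpen Basic U
  gext   : ∀ {U W : Pred₀ X} → (∀ x → U x ⇔ W x) → GenOpen Basic U → GenOpen Basic W
  gwhole : GenOpen Basic (λ _ → ⊤)
  ginter : ∀ {U W} → GenOpen Basic U → GenOpen Basic W → GenOpen Basic (λ x → U x × W x)
  gunion : ∀ {I : Set} (U : I → Pred₀ X) → (∀ i → GenOpen Basic (U i))
          → GenOpen Basic (λ x → Σ I (λ i → U i x))

generated : {X : Set} → (Pred₀ X → Set₁) → Topology X
generated B = record
  { Open = GenOpen B ; ext = gext ; whole = gwhole ; inter = ginter ; union = gunion }

-- Copower A · X in Top: coproduct of A copies of X, i.e. A × X with A
-- discrete.  A subset is open iff each of its slices is open.
copowerTop : (A : Set) {X : Set} → Topology X → Topology (A × X)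
copowerTop A τ = record
  { Open  = λ W → ∀ a → Open τ (λ x → W (a , x))
  ; ext   = λ e o a → ext τ (λ x → e (a , x)) (o a)
  ; whole = λ a → whole τ
  ; inter = λ o o' a → inter τ (o a) (o' a)
  ; union = λ U o a → union τ (λ i x → U i (a , x)) (λ i → o i a)
  }

Continuous : {X Y : Set} → Topology X → Topology Y → (X → Y) → Set₁
Continuous τX τY f = ∀ U → Open τY U → Open τX (λ x → U (f x))

record Signature : Set₁ where
  field
    Sym : Set
    ar  : Sym → Set
open Signature public

data Term (Sg : Signature) (V : Set) : Set where
  var : V → Term Sg V
  app : (σ : Sym Sg) → (ar Sg σ → Term Sg V) → Term Sg V

record Theory : Set₁ where
  field
    sig    : Signature
    Eqn    : Set
    EqVars : Eqn → Set
    lhs    : (e : Eqn) → Term sig (EqVars e)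
    rhs    : (e : Eqn) → Term sig (EqVars e)
open Theory public

CoOps : Signature → Set → Set
CoOps Sg S = (σ : Sym Sg) → S → ar Sg σ × S

⟦_⟧ : ∀ {Sg S V} → Term Sg V → CoOps Sg S → S → V × S
⟦ var v ⟧ c s = v , s
⟦ app σ ts ⟧ c s = ⟦ ts (proj₁ (c σ s)) ⟧ c (proj₂ (c σ s))

Satisfies : (T : Theory) {S : Set} → CoOps (sig T) S → Set
Satisfies T {S} c = ∀ (e : Eqn T) (s : S) → ⟦ lhs T e ⟧ c s ≡ ⟦ rhs T e ⟧ c s

record Comodel (T : Theory) : Set₁ where
  field
    Carrier : Set
    coop    : CoOps (sig T) Carrier
    sat     : Satisfies T coop
open Comodel public

IsMorphism : ∀ {Sg} {S S' : Set} → CoOps Sg S → CoOps Sg S' → (S → S') → Set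
IsMorphism {Sg} {S} c c' h = ∀ (σ : Sym Sg) (s : S) → c' σ (h s) ≡ map₂ h (c σ s)

record ComodelHom {T : Theory} (A B : Comodel T) : Set where
  field
    fun   : Carrier A → Carrier B
    hom   : IsMorphism (coop A) (coop B) fun
open ComodelHom public

IsFinal : {T : Theory} → Comodel T → Set₁
IsFinal {T} F = ∀ (A : Comodel T) → Σ (ComodelHom A F) λ h →
  ∀ (k : ComodelHom A F) → ∀ a → fun k a ≡ fun h a

[_↦_] : ∀ {Sg S V} → Term Sg V → V → CoOps Sg S → Pred₀ S
[ t ↦ v ] c s = Σ _ λ s' → ⟦ t ⟧ c s ≡ (v , s')

OpSubbasic : ∀ {Sg S} → CoOps Sg S → Pred₀ S → Set₁
OpSubbasic {Sg} {S} c U =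
  Σ Set λ V → Σ (Term Sg V) λ t → Σ V λ v → ∀ s → U s ⇔ [ t ↦ v ] c s

operationalTop : {T : Theory} (A : Comodel T) → Topology (Carrier A)
operationalTop A = generated (OpSubbasic (coop A))

record TopComodel (T : Theory) : Set₂ where
  field
    tCarrier : Set
    tTop     : Topology tCarrier
    tcoop    : CoOps (sig T) tCarrier
    tcont    : ∀ σ → Continuous tTop (copowerTop (ar (sig T) σ) tTop) (tcoop σ)
    tsat     : Satisfies T tcoop
open TopComodel public

record TopHomInto {T : Theory} (X : TopComodel T) (F : Comodel T)
                  (τF : Topology (Carrier F)) : Set₁ where
  field
    tfun  : tCarrier X → Carrier F
    tcnt  : Continuous (tTop X) τF tfun
    thom  : IsMorphism (tcoop X) (coop F) tfun
open TopHomInto public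

-- (F, τF) (whose co-operations are assumed continuous elsewhere) is
-- final among topological comodels.
IsFinalTop : {T : Theory} (F : Comodel T) → Topology (Carrier F) → Set₂
IsFinalTop {T} F τF = ∀ (X : TopComodel T) → Σ (TopHomInto X F τF) λ h →
  ∀ (k : TopHomInto X F τF) → ∀ x → tfun k x ≡ tfun h x

-- The operational topology is, by design, the coarsest topology in which every
-- derived co-operation ⟦ t ⟧ has open "output fibres" [ t ↦ v ].  A co-operation
-- σ is continuous for it because [ t ↦ v ] pulls back along the state part of σ
-- to [ σ(t, …, t) ↦ v ], while the output fibres of σ itself are [ σ(var) ↦ a ].
-- Conversely, in any topological comodel X every [ t ↦ v ] is open (induction on
-- t, using continuity of the co-operations), and comodel morphisms preserve the
-- output of derived co-operations; so the unique morphism from X to the final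
-- comodel pulls subbasic opens back to opens, i.e. it is continuous.
module Submission where

open import Defs
open import Data.Unit using (⊤; tt)
open import Data.Product using (Σ; _×_; _,_; proj₁; proj₂; map₂)
open import Function.Base using (_∘_; const)
open import Function.Bundles using (_⇔_; mk⇔)
open import Function.Properties.Equivalence using () renaming (sym to ⇔-sym; trans to ⇔-trans)
open import Relation.Binary.PropositionalEquality using (_≡_; refl; sym; trans; cong)

const-open : {X : Set} (τ : Topology X) (P : Set) → Open τ (λ _ → P)
const-open τ P = ext τ (λ _ → mk⇔ proj₁ (_, tt)) (union τ (λ _ _ → ⊤) (λ _ → whole τ))

continuous-generated : {X Y : Set} (τ : Topology X) {B : Pred₀ Y → Set₁} (f : X → Y) →
  (∀ U → B U → Open τ (U ∘ f)) → Continuous τ (generated B) f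
continuous-generated τ f basic U (gbasic b) = basic U b
continuous-generated τ f basic U (gext e o) =
  ext τ (e ∘ f) (continuous-generated τ f basic _ o)
continuous-generated τ f basic U gwhole = whole τ
continuous-generated τ f basic U (ginter o o') =
  inter τ (continuous-generated τ f basic _ o) (continuous-generated τ f basic _ o')
continuous-generated τ f basic U (gunion V os) =
  union τ (λ i → V i ∘ f) (λ i → continuous-generated τ f basic _ (os i))

copower-continuous : {A X Y : Set} (τX : Topology X) (τY : Topology Y) (f : X → A × Y) →
  (∀ a → Open τX (λ x → proj₁ (f x) ≡ a)) → Continuous τX τY (proj₂ ∘ f) →
  Continuous τX (copowerTop A τY) f
copower-continuous τX τY f fibre-open snd-cont U U-open =
  ext τX slices (union τX (λ a x → proj₁ (f x) ≡ a × U (a , proj₂ (f x)))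
                          (λ a → inter τX (fibre-open a) (snd-cont _ (U-open a))))
  where
  slices : ∀ x → Σ _ (λ a → proj₁ (f x) ≡ a × U (a , proj₂ (f x))) ⇔ U (f x)
  slices x = mk⇔ (λ { (_ , refl , u) → u }) (λ u → proj₁ (f x) , refl , u)

[↦]⇔proj₁≡ : ∀ {Sg S V} (c : CoOps Sg S) (t : Term Sg V) (v : V) (s : S) →
  [ t ↦ v ] c s ⇔ (proj₁ (⟦ t ⟧ c s) ≡ v)
[↦]⇔proj₁≡ c t v s =
  mk⇔ (λ (_ , p) → cong proj₁ p) (λ e → proj₂ (⟦ t ⟧ c s) , cong (_, proj₂ (⟦ t ⟧ c s)) e)

⟦⟧-morphism : ∀ {Sg S S' V} (c : CoOps Sg S) (c' : CoOps Sg S') {h : S → S'} →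
  IsMorphism c c' h → (t : Term Sg V) (s : S) → ⟦ t ⟧ c' (h s) ≡ map₂ h (⟦ t ⟧ c s)
⟦⟧-morphism c c' hom (var v) s = refl
⟦⟧-morphism c c' hom (app σ ts) s rewrite hom σ s =
  ⟦⟧-morphism c c' hom (ts (proj₁ (c σ s))) (proj₂ (c σ s))

[↦]-morphism : ∀ {Sg S S' V} (c : CoOps Sg S) (c' : CoOps Sg S') {h : S → S'} →
  IsMorphism c c' h → (t : Term Sg V) (v : V) (s : S) → [ t ↦ v ] c s ⇔ [ t ↦ v ] c' (h s)
[↦]-morphism c c' hom t v s =
  ⇔-trans ([↦]⇔proj₁≡ c t v s) (⇔-trans same-output (⇔-sym ([↦]⇔proj₁≡ c' t v _)))
  where
  output : proj₁ (⟦ t ⟧ c' _) ≡ proj₁ (⟦ t ⟧ c s)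
  output = cong proj₁ (⟦⟧-morphism c c' hom t s)
  same-output : (proj₁ (⟦ t ⟧ c s) ≡ v) ⇔ (proj₁ (⟦ t ⟧ c' _) ≡ v)
  same-output = mk⇔ (trans output) (trans (sym output))

module _ {Sg : Signature} {S : Set} (c : CoOps Sg S) (σ : Sym Sg) where

  private
    τ : Topology S
    τ = generated (OpSubbasic c)

  coop-state-continuous : Continuous τ τ (proj₂ ∘ c σ)
  coop-state-continuous = continuous-generated τ (proj₂ ∘ c σ) λ where
    U (V , t , v , e) → gbasic (V , app σ (const t) , v , e ∘ proj₂ ∘ c σ)

  coop-output-open : ∀ a → Open τ (λ s → proj₁ (c σ s) ≡ a)
  coop-output-open a = gbasic (ar Sg σ , app σ var , a , ⇔-sym ∘ [↦]⇔proj₁≡ c (app σ var) a)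

  coop-continuous : Continuous τ (copowerTop (ar Sg σ) τ) (c σ)
  coop-continuous = copower-continuous τ τ (c σ) coop-output-open coop-state-continuous

module _ {T : Theory} (X : TopComodel T) where

  [↦]-open : ∀ {V} (t : Term (sig T) V) (v : V) → Open (tTop X) ([ t ↦ v ] (tcoop X))
  [↦]-open (var w) v =
    ext (tTop X) (⇔-sym ∘ [↦]⇔proj₁≡ (tcoop X) (var w) v) (const-open (tTop X) (w ≡ v))
  [↦]-open (app σ ts) v =
    tcont X σ (λ (a , s) → [ ts a ↦ v ] (tcoop X) s) (λ a → [↦]-open (ts a) v)

  morphism-continuous : (F : Comodel T) {h : tCarrier X → Carrier F} →
    IsMorphism (tcoop X) (coop F) h → Continuous (tTop X) (operationalTop F) h
  morphism-continuous F {h} hom = continuous-generated (tTop X) h λ where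
    U (V , t , v , e) →
      ext (tTop X) (λ x → ⇔-trans ([↦]-morphism _ _ hom t v x) (⇔-sym (e (h x))))
          ([↦]-open t v)

  underlying : Comodel T
  underlying = record { Carrier = tCarrier X ; coop = tcoop X ; sat = tsat X }

lemma2p17 : (T : Theory) →
    ((A : Comodel T) → (σ : Sym (sig T)) →
       Continuous (operationalTop A) (copowerTop (ar (sig T) σ) (operationalTop A)) (coop A σ))
    × ((F : Comodel T) → IsFinal F → IsFinalTop F (operationalTop F))
lemma2p17 T = (λ A → coop-continuous (coop A)) , final-top
  where
  final-top : (F : Comodel T) → IsFinal F → IsFinalTop F (operationalTop F)
  final-top F final X = continuous-h , λ k → unique (record { fun = tfun k ; hom = thom k })
    where
    open Σ (final (underlying X)) renaming (proj₁ to h; proj₂ to unique)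
    continuous-h : TopHomInto X F (operationalTop F)
    continuous-h = record
      { tfun = fun h ; tcnt = morphism-continuous X F (hom h) ; thom = hom h }
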